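{- If $G$ is a finite connected graph with $|V(G)|=n$, then $F_{cd}(G\odot K_1) = n$.
   Context: The corona $G\odot K_1$ is obtained from $G$ by attaching to each vertex of $G$ one new pendant vertex. Color-change rule: if each vertex is colored black or white, and a black vertex $u$ has exactly one white neighbor $v$, then $v$ is recolored black. A zero forcing set of a graph is a vertex set $Z$ such that, starting with exactly the vertices of $Z$ black, repeated application of the color-change rule colors every vertex black. A connected dom-forcing set is a vertex set $S$ that is dominating (every vertex is in $S$ or adjacent to a vertex of $S$), induces a connected subgraph, and is a zero forcing set; $F_{cd}(\cdot)$ is the minimum size of such a set. -}

module Defs where

open import Data.Bool using (Bool; true; false)
open import Data.Nat using (ℕ; _+_; _≤_)
open import Data.Fin using (Fin; splitAt)
open import Data.Fin.Properties using (_≟_)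
open import Data.Fin.Subset using (Subset; _∈_; ∣_∣; ⊤)
open import Data.Sum using (_⊎_; inj₁; inj₂)
open import Data.Product using (Σ; ∃; _×_; _,_)
open import Relation.Binary.PropositionalEquality using (_≡_; _≢_)
open import Relation.Nullary.Decidable using (⌊_⌋)

Adjacency : ℕ → Set
Adjacency m = Fin m → Fin m → Bool

_~[_]_ : ∀ {m} → Fin m → Adjacency m → Fin m → Set
u ~[ A ] v = A u v ≡ true

record SimpleGraph (n : ℕ) : Set where
  field
    adj    : Adjacency n
    sym    : ∀ u v → adj u v ≡ adj v u
    irrefl : ∀ v → adj v v ≡ false
open SimpleGraph public

data ReachIn {m} (A : Adjacency m) (S : Subset m) : Fin m → Fin m → Set where
  here : ∀ {u} → u ∈ S → ReachIn A S u u
  step : ∀ {u w v} → u ∈ S → u ~[ A ] w → ReachIn A S w v → ReachIn A S u v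

InducedConnected : ∀ {m} → Adjacency m → Subset m → Set
InducedConnected A S = ∀ u v → u ∈ S → v ∈ S → ReachIn A S u v

Connected : ∀ {n} → SimpleGraph n → Set
Connected {n} G = ∀ u v → ReachIn (adj G) ⊤ u v

Dominating : ∀ {m} → Adjacency m → Subset m → Set
Dominating A S = ∀ v → v ∈ S ⊎ (∃ λ u → u ∈ S × u ~[ A ] v)

-- Vertices that end up black when starting with exactly Z black and
-- repeatedly applying the color-change rule (least closure under the rule):
-- a black vertex u all of whose neighbours other than v are black forces v.
data Black {m} (A : Adjacency m) (Z : Subset m) : Fin m → Set where
  init  : ∀ {v} → v ∈ Z → Black A Z v
  force : ∀ {u v} → Black A Z u → u ~[ A ] v
        → (∀ w → u ~[ A ] w → w ≢ v → Black A Z w)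
        → Black A Z v

ZeroForcing : ∀ {m} → Adjacency m → Subset m → Set
ZeroForcing A Z = ∀ v → Black A Z v

ConnectedDomForcing : ∀ {m} → Adjacency m → Subset m → Set
ConnectedDomForcing A S = Dominating A S × InducedConnected A S × ZeroForcing A S

FcdEquals : ∀ {m} → Adjacency m → ℕ → Set
FcdEquals A k =
  (Σ _ λ S → ConnectedDomForcing A S × ∣ S ∣ ≡ k)
  × (∀ S → ConnectedDomForcing A S → k ≤ ∣ S ∣)

-- Corona G ⊙ K₁ on Fin (n + n): vertex i ↑ˡ n is the original vertex i,
-- vertex n ↑ʳ i is the new pendant vertex attached to i.
coronaAdj : ∀ {n} → SimpleGraph n → Adjacency (n + n)
coronaAdj {n} G x y with splitAt n x | splitAt n y
... | inj₁ i | inj₁ j = adj G i j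
... | inj₁ i | inj₂ j = ⌊ i ≟ j ⌋
... | inj₂ i | inj₁ j = ⌊ i ≟ j ⌋
... | inj₂ i | inj₂ j = false

-- The original vertices of G ⊙ K₁ form a connected dom-forcing set of size n: they dominate
-- every pendant, induce a copy of the connected graph G, and each of them forces its own
-- pendant, its only white neighbour. Conversely a dominating set must contain, for every
-- vertex i of G, either i or its pendant, since these are the only neighbours of the pendant;
-- the n disjoint pairs give at least n elements.
module Submission where

open import Defs hiding (sym)
open import Data.Bool using (true; false)
open import Data.Bool.Properties using (T-≡)
open import Data.Empty using (⊥-elim)
open import Data.Fin using (Fin; splitAt; _↑ˡ_; _↑ʳ_)
open import Data.Fin.Properties using (_≟_; splitAt-↑ˡ; splitAt-↑ʳ; splitAt⁻¹-↑ˡ; splitAt⁻¹-↑ʳ)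
open import Data.Fin.Subset using (Subset; _∈_; _∉_; _∪_; _⊆_; ∣_∣; ⊤; ⊥; inside; outside)
open import Data.Fin.Subset.Properties using (∈⊤; ∉⊥; ∣⊤∣≡n; ∣⊥∣≡0; p⊆q⇒∣p∣≤∣q∣; x∈p∪q⁺)
open import Data.Nat using (ℕ; suc; _+_; _≤_; z≤n; s≤s)
open import Data.Nat.Properties using (≤-trans; ≤-reflexive; n≤1+n; +-monoʳ-≤; +-suc; +-identityʳ)
open import Data.Product using (_,_)
open import Data.Sum using (_⊎_; inj₁; inj₂)
open import Data.Vec using (_∷_; []; _++_; here; there)
import Data.Vec as Vec
open import Function.Bundles using (Equivalence)
open import Relation.Binary.PropositionalEquality using (_≡_; _≢_; refl; sym; trans; cong; cong₂; subst; ≡-≟-identity; module ≡-Reasoning)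
open import Relation.Nullary using (¬_)
open import Relation.Nullary.Decidable using (⌊_⌋; toWitness)

∈-++⁺ˡ : ∀ {m n} {p : Subset m} {q : Subset n} {i} → i ∈ p → (i ↑ˡ n) ∈ p ++ q
∈-++⁺ˡ here        = here
∈-++⁺ˡ (there i∈p) = there (∈-++⁺ˡ i∈p)

∈-++⁻ˡ : ∀ {m n} (p : Subset m) {q : Subset n} i → (i ↑ˡ n) ∈ p ++ q → i ∈ p
∈-++⁻ˡ (_ ∷ p) Fin.zero    here        = here
∈-++⁻ˡ (_ ∷ p) (Fin.suc i) (there i∈p) = there (∈-++⁻ˡ p i i∈p)

∈-++⁻ʳ : ∀ {m n} (p : Subset m) {q : Subset n} {i} → (m ↑ʳ i) ∈ p ++ q → i ∈ q
∈-++⁻ʳ []      i∈q         = i∈q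
∈-++⁻ʳ (_ ∷ p) (there i∈q) = ∈-++⁻ʳ p i∈q

∣p++q∣≡∣p∣+∣q∣ : ∀ {m n} (p : Subset m) (q : Subset n) → ∣ p ++ q ∣ ≡ ∣ p ∣ + ∣ q ∣
∣p++q∣≡∣p∣+∣q∣ []            q = refl
∣p++q∣≡∣p∣+∣q∣ (inside  ∷ p) q = cong suc (∣p++q∣≡∣p∣+∣q∣ p q)
∣p++q∣≡∣p∣+∣q∣ (outside ∷ p) q = ∣p++q∣≡∣p∣+∣q∣ p q

∣p∪q∣≤∣p∣+∣q∣ : ∀ {n} (p q : Subset n) → ∣ p ∪ q ∣ ≤ ∣ p ∣ + ∣ q ∣
∣p∪q∣≤∣p∣+∣q∣ []            []            = z≤n
∣p∪q∣≤∣p∣+∣q∣ (inside  ∷ p) (inside  ∷ q) =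
  s≤s (≤-trans (∣p∪q∣≤∣p∣+∣q∣ p q) (+-monoʳ-≤ ∣ p ∣ (n≤1+n ∣ q ∣)))
∣p∪q∣≤∣p∣+∣q∣ (inside  ∷ p) (outside ∷ q) = s≤s (∣p∪q∣≤∣p∣+∣q∣ p q)
∣p∪q∣≤∣p∣+∣q∣ (outside ∷ p) (inside  ∷ q) =
  ≤-trans (s≤s (∣p∪q∣≤∣p∣+∣q∣ p q)) (≤-reflexive (sym (+-suc ∣ p ∣ ∣ q ∣)))
∣p∪q∣≤∣p∣+∣q∣ (outside ∷ p) (outside ∷ q) = ∣p∪q∣≤∣p∣+∣q∣ p q

covering⇒n≤∣p∣+∣q∣ : ∀ {n} (p q : Subset n) → (∀ i → i ∈ p ⊎ i ∈ q) → n ≤ ∣ p ∣ + ∣ q ∣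
covering⇒n≤∣p∣+∣q∣ {n} p q cover = ≤-trans n≤∣p∪q∣ (∣p∪q∣≤∣p∣+∣q∣ p q)
  where
  ⊤⊆p∪q : ⊤ ⊆ p ∪ q
  ⊤⊆p∪q {i} _ = x∈p∪q⁺ (cover i)

  n≤∣p∪q∣ : n ≤ ∣ p ∪ q ∣
  n≤∣p∪q∣ = subst (_≤ ∣ p ∪ q ∣) (∣⊤∣≡n n) (p⊆q⇒∣p∣≤∣q∣ ⊤⊆p∪q)

≟-true⇒≡ : ∀ {n} {i j : Fin n} → ⌊ i ≟ j ⌋ ≡ true → i ≡ j
≟-true⇒≡ e = toWitness (Equivalence.from T-≡ e)

≟-diag-true : ∀ {n} (i : Fin n) → ⌊ i ≟ i ⌋ ≡ true
≟-diag-true i = cong ⌊_⌋ (≡-≟-identity _≟_ refl)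

data CoronaVertex (n : ℕ) : Fin (n + n) → Set where
  original : (i : Fin n) → CoronaVertex n (i ↑ˡ n)
  pendant  : (i : Fin n) → CoronaVertex n (n ↑ʳ i)

coronaVertex : ∀ n (x : Fin (n + n)) → CoronaVertex n x
coronaVertex n x with splitAt n x in eq
... | inj₁ i = subst (CoronaVertex n) (splitAt⁻¹-↑ˡ eq) (original i)
... | inj₂ i = subst (CoronaVertex n) (splitAt⁻¹-↑ʳ eq) (pendant i)

module Corona {n : ℕ} (G : SimpleGraph n) where

  A : Adjacency (n + n)
  A = coronaAdj G

  original-adj : ∀ i j → A (i ↑ˡ n) (j ↑ˡ n) ≡ adj G i j
  original-adj i j rewrite splitAt-↑ˡ n i n | splitAt-↑ˡ n j n = refl

  original-pendant-adj : ∀ i j → A (i ↑ˡ n) (n ↑ʳ j) ≡ ⌊ i ≟ j ⌋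
  original-pendant-adj i j rewrite splitAt-↑ˡ n i n | splitAt-↑ʳ n n j = refl

  pendant-pendant-adj : ∀ i j → A (n ↑ʳ i) (n ↑ʳ j) ≡ false
  pendant-pendant-adj i j rewrite splitAt-↑ʳ n n i | splitAt-↑ʳ n n j = refl

  original~pendant : ∀ i → (i ↑ˡ n) ~[ A ] (n ↑ʳ i)
  original~pendant i = trans (original-pendant-adj i i) (≟-diag-true i)

  original~pendant⇒≡ : ∀ {i j} → (i ↑ˡ n) ~[ A ] (n ↑ʳ j) → i ≡ j
  original~pendant⇒≡ {i} {j} e = ≟-true⇒≡ (trans (sym (original-pendant-adj i j)) e)

  pendant≁pendant : ∀ {i j} → ¬ (n ↑ʳ i) ~[ A ] (n ↑ʳ j)
  pendant≁pendant {i} {j} e with trans (sym (pendant-pendant-adj i j)) e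
  ... | ()

  dominating⇒original⊎pendant : ∀ {S} → Dominating A S → ∀ i → (i ↑ˡ n) ∈ S ⊎ (n ↑ʳ i) ∈ S
  dominating⇒original⊎pendant {S} dom i with dom (n ↑ʳ i)
  ... | inj₁ pendant∈S = inj₂ pendant∈S
  ... | inj₂ (u , u∈S , u~pendant) with coronaVertex n u
  ... | original j = inj₁ (subst (λ k → (k ↑ˡ n) ∈ S) (original~pendant⇒≡ u~pendant) u∈S)
  ... | pendant j  = ⊥-elim (pendant≁pendant u~pendant)

  dominating⇒n≤∣S∣ : ∀ S → Dominating A S → n ≤ ∣ S ∣
  dominating⇒n≤∣S∣ S dom with Vec.splitAt n S
  ... | p , q , refl = subst (n ≤_) (sym (∣p++q∣≡∣p∣+∣q∣ p q)) (covering⇒n≤∣p∣+∣q∣ p q cover)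
    where
    cover : ∀ i → i ∈ p ⊎ i ∈ q
    cover i with dominating⇒original⊎pendant dom i
    ... | inj₁ i∈S = inj₁ (∈-++⁻ˡ p i i∈S)
    ... | inj₂ i∈S = inj₂ (∈-++⁻ʳ p i∈S)

  originals : Subset (n + n)
  originals = ⊤ {n} ++ ⊥ {n}

  original∈originals : ∀ i → (i ↑ˡ n) ∈ originals
  original∈originals i = ∈-++⁺ˡ ∈⊤

  pendant∉originals : ∀ i → (n ↑ʳ i) ∉ originals
  pendant∉originals i i∈ = ∉⊥ (∈-++⁻ʳ (⊤ {n}) i∈)

  ∣originals∣≡n : ∣ originals ∣ ≡ n
  ∣originals∣≡n = begin
    ∣ ⊤ {n} ++ ⊥ {n} ∣    ≡⟨ ∣p++q∣≡∣p∣+∣q∣ (⊤ {n}) ⊥ ⟩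
    ∣ ⊤ {n} ∣ + ∣ ⊥ {n} ∣ ≡⟨ cong₂ _+_ (∣⊤∣≡n n) (∣⊥∣≡0 n) ⟩
    n + 0                 ≡⟨ +-identityʳ n ⟩
    n                     ∎
    where open ≡-Reasoning

  originals-dominating : Dominating A originals
  originals-dominating x with coronaVertex n x
  ... | original i = inj₁ (original∈originals i)
  ... | pendant i  = inj₂ (i ↑ˡ n , original∈originals i , original~pendant i)

  walk⇒walkThroughOriginals : ∀ {i j} → ReachIn (adj G) ⊤ i j → ReachIn A originals (i ↑ˡ n) (j ↑ˡ n)
  walk⇒walkThroughOriginals (here _)               = here (original∈originals _)
  walk⇒walkThroughOriginals (step {u} {w} _ e walk) =
    step (original∈originals u) (trans (original-adj u w) e) (walk⇒walkThroughOriginals walk)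

  originals-connected : Connected G → InducedConnected A originals
  originals-connected conn x y x∈ y∈ with coronaVertex n x | coronaVertex n y
  ... | original i | original j = walk⇒walkThroughOriginals (conn i j)
  ... | pendant i  | _          = ⊥-elim (pendant∉originals i x∈)
  ... | original _ | pendant j  = ⊥-elim (pendant∉originals j y∈)

  originals-zeroForcing : ZeroForcing A originals
  originals-zeroForcing x with coronaVertex n x
  ... | original i = init (original∈originals i)
  ... | pendant i  = force (init (original∈originals i)) (original~pendant i) othersBlack
    where
    othersBlack : ∀ w → (i ↑ˡ n) ~[ A ] w → w ≢ (n ↑ʳ i) → Black A originals w
    othersBlack w e w≢ with coronaVertex n w
    ... | original j = init (original∈originals j)
    ... | pendant j  = ⊥-elim (w≢ (cong (n ↑ʳ_) (sym (original~pendant⇒≡ e))))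

open Corona

mainTheorem12 : (n : ℕ) (G : SimpleGraph n) → Connected G → FcdEquals (coronaAdj G) n
mainTheorem12 n G conn =
  ( originals G
  , (originals-dominating G , originals-connected G conn , originals-zeroForcing G)
  , ∣originals∣≡n G )
  , λ S (dom , _ , _) → dominating⇒n≤∣S∣ G S dom
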